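{- Let $G$ be a labelled graph with labels in $L$ and $\star:L\times L\to\{0,1\}$. Then $G\cdot_\star\zeta$, $G\cdot_\star\omega^d$ and $G\cdot_\star\omega$ have the same age.
   Context: For a chain $C=(I,\le)$, $G\cdot_\star C$ is the labelled graph on $I\times V(G)$ with $(i,x)$ labelled $\ell(x)$, $(i,x)\sim(i,y)$ iff $x\sim y$ in $G$, and for $i<j$ in $C$, $(i,x)\sim(j,y)$ iff $\ell(x)\star\ell(y)=1$. $\omega,\omega^d,\zeta$ are the chains $(\mathbb{N},\le)$, its reverse, and $(\mathbb{Z},\le)$. The age of a labelled graph is the class of finite labelled graphs that embed into it (as induced subgraphs, preserving labels), up to isomorphism. -}

module Defs where

open import Data.Nat using (ℕ)
import Data.Nat as ℕ
open import Data.Integer using (ℤ)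
import Data.Integer as ℤ
open import Data.Fin using (Fin)
open import Data.Bool using (Bool; true)
open import Data.Product using (_×_; _,_; Σ)
open import Data.Sum using (_⊎_)
open import Relation.Binary.PropositionalEquality using (_≡_; refl)
import Data.Nat.Properties as NP
import Data.Integer.Properties as ZP
open import Relation.Nullary using (¬_)
open import Function.Definitions using (Injective)
open import Function.Bundles using (_⇔_)

record LGraph (L : Set) (V : Set) : Set₁ where
  field
    _~_    : V → V → Set
    ~-sym  : ∀ {x y} → x ~ y → y ~ x
    ~-irr  : ∀ {x} → ¬ (x ~ x)
    label  : V → L
open LGraph public

-- A chain: a carrier with a strict total order (only the strict order is used).
record Chain : Set₁ where
  field
    Idx : Set
    _<ᶜ_ : Idx → Idx → Set
    <ᶜ-irr : ∀ {i} → ¬ (i <ᶜ i)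
open Chain public

ω : Chain
ω = record { Idx = ℕ ; _<ᶜ_ = ℕ._<_ ; <ᶜ-irr = NP.<-irrefl refl }

ωᵈ : Chain
ωᵈ = record { Idx = ℕ ; _<ᶜ_ = λ i j → j ℕ.< i ; <ᶜ-irr = NP.<-irrefl refl }

ζ : Chain
ζ = record { Idx = ℤ ; _<ᶜ_ = ℤ._<_ ; <ᶜ-irr = ZP.<-irrefl refl }

data ProdAdj {L V : Set} (G : LGraph L V) (⋆ : L → L → Bool) (C : Chain)
     : Idx C × V → Idx C × V → Set where
  same : ∀ {i x y} → _~_ G x y → ProdAdj G ⋆ C (i , x) (i , y)
  lo   : ∀ {i j x y} → _<ᶜ_ C i j → ⋆ (label G x) (label G y) ≡ true
       → ProdAdj G ⋆ C (i , x) (j , y)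
  hi   : ∀ {i j x y} → _<ᶜ_ C j i → ⋆ (label G y) (label G x) ≡ true
       → ProdAdj G ⋆ C (i , x) (j , y)

_·[_]_ : {L V : Set} → LGraph L V → (L → L → Bool) → (C : Chain) → LGraph L (Idx C × V)
_·[_]_ {L} {V} G ⋆ C = record
  { _~_   = ProdAdj G ⋆ C
  ; ~-sym = sym'
  ; ~-irr = irr'
  ; label = λ p → label G (Data.Product.proj₂ p)
  }
  where
  sym' : ∀ {p q} → ProdAdj G ⋆ C p q → ProdAdj G ⋆ C q p
  sym' (same e) = same (~-sym G e)
  sym' (lo i<j e) = hi i<j e
  sym' (hi j<i e) = lo j<i e
  irr' : ∀ {p} → ¬ ProdAdj G ⋆ C p p
  irr' (same e) = ~-irr G e
  irr' (lo i<i e) = <ᶜ-irr C i<i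
  irr' (hi i<i e) = <ᶜ-irr C i<i

record Embedding {L V W : Set} (H : LGraph L V) (K : LGraph L W) : Set where
  field
    map       : V → W
    injective : ∀ {x y} → map x ≡ map y → x ≡ y
    lab       : ∀ x → label K (map x) ≡ label H x
    adj       : ∀ x y → (_~_ H x y ⇔ _~_ K (map x) (map y))

InAge : {L W : Set} → LGraph L W → (n : ℕ) → LGraph L (Fin n) → Set
InAge K n H = Embedding H K

SameAge : {L V W : Set} → LGraph L V → LGraph L W → Set₁
SameAge {L} K K' = ∀ (n : ℕ) (H : LGraph L (Fin n)) → InAge K n H ⇔ InAge K' n H

-- Whether (i,x) ~ (j,y) in G ·⋆ C depends on i, j only through i = j, i < j
-- and j < i, so any map of chains that is injective and preserves and reflects
-- the order on the indices actually used turns an embedding H ↪ G ·⋆ C into an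
-- embedding H ↪ G ·⋆ D.  ω and ωᵈ sit inside ζ as n ↦ n and n ↦ -1-n.
-- Conversely a finite H ↪ G ·⋆ ζ only uses indices in some [-S, S], and
-- i ↦ i + S (resp. i ↦ S - i) maps these order-embeddingly into ω (resp. ωᵈ).
module Submission where

open import Defs
open import Algebra.Bundles using (AbelianGroup)
open import Data.Bool using (Bool)
open import Data.Fin using (Fin)
open import Data.Integer as ℤ using (ℤ; +_; -[1+_]; ∣_∣; -_; 0ℤ)
import Data.Integer.Properties as ℤₚ
open import Data.List as List using (allFin)
open import Data.List.Extrema.Nat using (max; xs≤max)
open import Data.List.Membership.Propositional.Properties using (∈-map⁺; ∈-allFin)
import Data.List.Relation.Unary.All as All
open import Data.Nat as ℕ using (ℕ)
open import Data.Product using (_×_; _,_; proj₁; proj₂)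
open import Data.Unit using (⊤; tt)
open import Function using (_∘_)
open import Function.Bundles using (_⇔_; mk⇔; Equivalence)
open import Function.Construct.Composition using (_⇔-∘_)
open import Relation.Binary.PropositionalEquality

open import Algebra.Properties.Group (AbelianGroup.group ℤₚ.+-0-abelianGroup)
  using (//-rightDividesʳ)

record OrderEmbeddingOn (C D : Chain) (P : Idx C → Set) : Set where
  field
    map       : Idx C → Idx D
    injective : ∀ {i j} → P i → P j → map i ≡ map j → i ≡ j
    <-iff     : ∀ {i j} → P i → P j → _<ᶜ_ C i j ⇔ _<ᶜ_ D (map i) (map j)
open OrderEmbeddingOn

OrderEmbedding : Chain → Chain → Set
OrderEmbedding C D = OrderEmbeddingOn C D (λ _ → ⊤)

_ᵈ : Chain → Chain
C ᵈ = record { Idx = Idx C ; _<ᶜ_ = λ i j → _<ᶜ_ C j i ; <ᶜ-irr = <ᶜ-irr C }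

dual : ∀ {C D P} → OrderEmbeddingOn C D P → OrderEmbeddingOn (C ᵈ) (D ᵈ) P
dual φ = record
  { map       = map φ
  ; injective = injective φ
  ; <-iff     = λ pi pj → <-iff φ pj pi
  }

compose : ∀ {C D E} {P : Idx C → Set} {Q : Idx D → Set}
  (ψ : OrderEmbeddingOn D E Q) (φ : OrderEmbedding C D) →
  (∀ i → P i → Q (map φ i)) → OrderEmbeddingOn C E P
compose ψ φ P⇒Q = record
  { map       = map ψ ∘ map φ
  ; injective = λ pi pj → injective φ _ _ ∘ injective ψ (P⇒Q _ pi) (P⇒Q _ pj)
  ; <-iff     = λ pi pj → <-iff ψ (P⇒Q _ pi) (P⇒Q _ pj) ⇔-∘ <-iff φ _ _
  }

module _ {L V : Set} (G : LGraph L V) (⋆ : L → L → Bool) where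

  module _ {C D : Chain} {P : Idx C → Set} (φ : OrderEmbeddingOn C D P) where

    ProdAdj-preserve : ∀ {i j x y} → P i → P j →
      ProdAdj G ⋆ C (i , x) (j , y) → ProdAdj G ⋆ D (map φ i , x) (map φ j , y)
    ProdAdj-preserve pi pj (same e) = same e
    ProdAdj-preserve pi pj (lo i<j e) = lo (Equivalence.to (<-iff φ pi pj) i<j) e
    ProdAdj-preserve pi pj (hi j<i e) = hi (Equivalence.to (<-iff φ pj pi) j<i) e

    -- The indices k, l are kept abstract so that matching on same does not
    -- have to unify map φ i with map φ j.
    ProdAdj-reflect : ∀ {i j k l x y} → P i → P j → k ≡ map φ i → l ≡ map φ j →
      ProdAdj G ⋆ D (k , x) (l , y) → ProdAdj G ⋆ C (i , x) (j , y)
    ProdAdj-reflect pi pj refl φi≡φj (same e) rewrite injective φ pi pj φi≡φj = same e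
    ProdAdj-reflect pi pj refl refl (lo φi<φj e) = lo (Equivalence.from (<-iff φ pi pj) φi<φj) e
    ProdAdj-reflect pi pj refl refl (hi φj<φi e) = hi (Equivalence.from (<-iff φ pj pi) φj<φi) e

    reindex : ∀ {n} {H : LGraph L (Fin n)} (e : Embedding H (G ·[ ⋆ ] C)) →
      (∀ u → P (proj₁ (Embedding.map e u))) → Embedding H (G ·[ ⋆ ] D)
    reindex e P-index = record
      { map       = λ u → map φ (proj₁ (Embedding.map e u)) , proj₂ (Embedding.map e u)
      ; injective = λ {u} {v} eq → Embedding.injective e
          (cong₂ _,_ (injective φ (P-index u) (P-index v) (cong proj₁ eq)) (cong proj₂ eq))
      ; lab       = Embedding.lab e
      ; adj       = λ u v → mk⇔
          (ProdAdj-preserve (P-index u) (P-index v) ∘ Equivalence.to (Embedding.adj e u v))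
          (Equivalence.from (Embedding.adj e u v) ∘ ProdAdj-reflect (P-index u) (P-index v) refl refl)
      }

ℕ↪ζ : OrderEmbedding ω ζ
ℕ↪ζ = record
  { map       = +_
  ; injective = λ _ _ → ℤₚ.+-injective
  ; <-iff     = λ _ _ → mk⇔ ℤ.+<+ ℤₚ.drop‿+<+
  }

ℕᵈ↪ζ : OrderEmbedding ωᵈ ζ
ℕᵈ↪ζ = record
  { map       = -[1+_]
  ; injective = λ _ _ → ℤₚ.-[1+-injective
  ; <-iff     = λ _ _ → mk⇔ ℤ.-<- ℤₚ.drop‿-<-
  }

neg : OrderEmbedding ζ (ζ ᵈ)
neg = record
  { map       = -_
  ; injective = λ _ _ → ℤₚ.neg-injective
  ; <-iff     = λ _ _ → mk⇔ ℤₚ.neg-mono-< ℤₚ.neg-cancel-<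
  }

translate : ℤ → OrderEmbedding ζ ζ
translate k = record
  { map       = ℤ._+ k
  ; injective = λ _ _ eq → untranslate (cong (ℤ._- k) eq)
  ; <-iff     = λ _ _ → mk⇔ (ℤₚ.+-monoˡ-< k)
      (subst₂ ℤ._<_ (//-rightDividesʳ k _) (//-rightDividesʳ k _) ∘ ℤₚ.+-monoˡ-< (- k))
  }
  where
  untranslate : ∀ {i j} → i ℤ.+ k ℤ.- k ≡ j ℤ.+ k ℤ.- k → i ≡ j
  untranslate {i} {j} eq = trans (sym (//-rightDividesʳ k i)) (trans eq (//-rightDividesʳ k j))

∣∣-on-nonnegative : OrderEmbeddingOn ζ ω (0ℤ ℤ.≤_)
∣∣-on-nonnegative = record
  { map       = ∣_∣
  ; injective = λ { (ℤ.+≤+ _) (ℤ.+≤+ _) → cong +_ }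
  ; <-iff     = λ { (ℤ.+≤+ _) (ℤ.+≤+ _) → mk⇔ ℤₚ.drop‿+<+ ℤ.+<+ }
  }

Bounded : ℕ → ℤ → Set
Bounded S i = ∣ i ∣ ℕ.≤ S

bounded⇒nonnegative-shift : ∀ {S} i → Bounded S i → 0ℤ ℤ.≤ i ℤ.+ + S
bounded⇒nonnegative-shift (+ m) _ = ℤ.+≤+ ℕ.z≤n
bounded⇒nonnegative-shift -[1+ m ] m<S rewrite ℤₚ.⊖-≥ m<S = ℤ.+≤+ ℕ.z≤n

ζ↪ω-on-bounded : ∀ S → OrderEmbeddingOn ζ ω (Bounded S)
ζ↪ω-on-bounded S = compose ∣∣-on-nonnegative (translate (+ S)) bounded⇒nonnegative-shift

ζ↪ωᵈ-on-bounded : ∀ S → OrderEmbeddingOn ζ ωᵈ (Bounded S)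
ζ↪ωᵈ-on-bounded S = compose (dual (ζ↪ω-on-bounded S)) neg
  (λ i → subst (ℕ._≤ S) (sym (ℤₚ.∣-i∣≡∣i∣ i)))

≤-maximum : ∀ {n} (f : Fin n → ℕ) u → f u ℕ.≤ max 0 (List.map f (allFin n))
≤-maximum f u = All.lookup (xs≤max 0 (List.map f (allFin _))) (∈-map⁺ f (∈-allFin u))

module _ {L V : Set} (G : LGraph L V) (⋆ : L → L → Bool) {n : ℕ} {H : LGraph L (Fin n)} where

  reindex-total : ∀ {C D} → OrderEmbedding C D → Embedding H (G ·[ ⋆ ] C) → Embedding H (G ·[ ⋆ ] D)
  reindex-total φ e = reindex G ⋆ φ e (λ _ → tt)

  reindex-bounded : ∀ {D} → (∀ S → OrderEmbeddingOn ζ D (Bounded S)) →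
    Embedding H (G ·[ ⋆ ] ζ) → Embedding H (G ·[ ⋆ ] D)
  reindex-bounded φ e = reindex G ⋆ (φ _) e (≤-maximum (∣_∣ ∘ proj₁ ∘ Embedding.map e))

corollary1 : {L V : Set} (G : LGraph L V) (⋆ : L → L → Bool) →
    SameAge (G ·[ ⋆ ] ζ) (G ·[ ⋆ ] ωᵈ) × SameAge (G ·[ ⋆ ] ζ) (G ·[ ⋆ ] ω)
corollary1 G ⋆ =
    (λ _ _ → mk⇔ (reindex-bounded G ⋆ ζ↪ωᵈ-on-bounded) (reindex-total G ⋆ ℕᵈ↪ζ))
  , (λ _ _ → mk⇔ (reindex-bounded G ⋆ ζ↪ω-on-bounded) (reindex-total G ⋆ ℕ↪ζ))
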